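{- Let $\mathcal{P}$ be a chiral and totally chiral $n$-polytope, let $\mathcal{Q}$ be a directly regular $n$-polytope, and suppose that $\Gamma^{+}(\mathcal{P})\diamondsuit\Gamma^{+}(\mathcal{Q})$ has the intersection property. If $\Gamma^{+}(\mathcal{P})\times\Gamma^{+}(\mathcal{Q})$ does not have a subgroup which has a quotient isomorphic to $\Gamma^{+}(\mathcal{P})\times\Gamma^{+}(\mathcal{P})$ (in particular, if $\mathcal{P}$ and $\mathcal{Q}$ are finite and $|\Gamma^{+}(\mathcal{P})|$ does not divide $|\Gamma^{+}(\mathcal{Q})|$), then $\mathcal{P}\diamondsuit\mathcal{Q}$ is a chiral polytope.
   Context: $\Gamma(\mathcal P)$ is the automorphism group. For chiral $\mathcal P$, $\Gamma(\mathcal P)$ is generated by distinguished rotations $\sigma_1,\dots,\sigma_{n-1}$ with respect to a base flag, and $\Gamma^+(\mathcal P):=\Gamma(\mathcal P)$; for regular $\mathcal Q$ with generating involutions $\rho_i$, $\Gamma^+(\mathcal Q)=\langle\sigma'_i=\rho_{i-1}\rho_i\rangle$, and $\mathcal Q$ is directly regular if this has index 2. The mix $\Gamma^+(\mathcal P)\diamondsuit\Gamma^+(\mathcal Q)$ is the subgroup of the direct product generated by $\tau_j=(\sigma_j,\sigma'_j)$; intersection property: with $\kappa_{i,j}=\tau_i\cdots\tau_j$, $\kappa_{0,i}=\kappa_{i,n}=\epsilon$, $\Gamma^I=\langle\kappa_{i,j}: i\le j,\ i-1\in I,\ j\in I\rangle$, require $\Gamma^I\cap\Gamma^J=\Gamma^{I\cap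 J}$ for all $I,J\subseteq\{ -1,\dots,n\}$; then the mix is the group of a chiral $n$-polytope or the rotation group of a directly regular $n$-polytope, denoted $\mathcal P\diamondsuit\mathcal Q$. Totally chiral: let $W=\langle r_0,\dots,r_{n-1}\mid r_i^2=(r_ir_j)^2=\epsilon,\ |i-j|\ge2\rangle$, $W^+=\langle s_i=r_{i-1}r_i\rangle$, and $M\trianglelefteq W^+$ the kernel of $s_i\mapsto\sigma_i$; $\mathcal P$ is totally chiral if $M\cdot r_0Mr_0^{ -1}=W^+$. -}

module Defs where

open import Level using (Level; _⊔_) renaming (zero to 0ℓ)
open import Algebra.Bundles using (Group)
import Algebra.Construct.DirectProduct as DP
open import Data.Nat using (ℕ; zero; suc; _≤_; _<_; _∸_; _+_; s≤s; z≤n)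
open import Data.Nat.Properties using (≤-<-trans; m∸n≤m)
open import Data.Fin using (Fin; fromℕ<; toℕ)
open import Data.Fin.Subset using (Subset; _∈_; _∩_)
open import Data.Bool using (Bool; true; false)
open import Data.List using (List; []; _∷_; _++_; [_]; concatMap)
open import Data.Product using (Σ; Σ-syntax; _×_; _,_; proj₁)
open import Data.Sum using (_⊎_)
open import Relation.Nullary using (¬_)
open import Relation.Binary.Construct.Closure.Equivalence using (EqClosure)

_∈ℕ_ : {m : ℕ} → ℕ → Subset m → Set
_∈ℕ_ {m} k I = Σ (k < m) λ p → fromℕ< p ∈ I

module _ {c ℓ : Level} (G : Group c ℓ) where
  open Group G

  eval : {A : Set} → (A → Carrier) → List (A × Bool) → Carrier
  eval f [] = ε
  eval f ((a , false) ∷ w) = f a ∙ eval f w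
  eval f ((a , true) ∷ w) = (f a ⁻¹) ∙ eval f w

  Gen : {A : Set} → (A → Carrier) → Carrier → Set ℓ
  Gen {A} f x = Σ[ w ∈ List (A × Bool) ] eval f w ≈ x

  prodFrom : (ℕ → Carrier) → ℕ → ℕ → Carrier
  prodFrom σ i zero = σ i
  prodFrom σ i (suc k) = prodFrom σ i k ∙ σ (suc (i + k))

  κ : (ℕ → Carrier) → ℕ → ℕ → Carrier
  κ σ i j = prodFrom σ i (j ∸ i)

  SIdx : ℕ → Set
  SIdx n = Σ[ i ∈ ℕ ] (1 ≤ i × i < n)

  InRot : (n : ℕ) → (ℕ → Carrier) → Carrier → Set ℓ
  InRot n σ = Gen {SIdx n} (λ a → σ (proj₁ a))

  -- subsets I ⊆ {-1,0,…,n} are encoded as Subset (2 + n), position k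
  -- standing for the index k - 1.  Generators of Γ^I: κ_{i,j} with
  -- 1 ≤ i ≤ j ≤ n-1, i-1 ∈ I, j ∈ I (the κ_{0,i}, κ_{i,n} are ε).
  KIdx : (n : ℕ) → Subset (2 + n) → Set
  KIdx n I = Σ[ i ∈ ℕ ] Σ[ j ∈ ℕ ]
    (1 ≤ i × i ≤ j × j < n × (i ∈ℕ I) × (suc j ∈ℕ I))

  ΓI : (n : ℕ) → (ℕ → Carrier) → Subset (2 + n) → Carrier → Set ℓ
  ΓI n σ I = Gen {KIdx n I} (λ { (i , j , _) → κ σ i j })

  -- the intersection property Γ^I ∩ Γ^J = Γ^{I∩J}
  -- (the inclusion ⊇ is automatic)
  IntersectionProperty : (n : ℕ) → (ℕ → Carrier) → Set (c ⊔ ℓ)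
  IntersectionProperty n σ = (I J : Subset (2 + n)) (x : Carrier) →
    ΓI n σ I x → ΓI n σ J x → ΓI n σ (I ∩ J) x

  RotRelations : (n : ℕ) → (ℕ → Carrier) → Set ℓ
  RotRelations n σ = (i j : ℕ) → 1 ≤ i → i < j → j < n →
    κ σ i j ∙ κ σ i j ≈ ε

  IsRotationGroup : (n : ℕ) → (ℕ → Carrier) → Set (c ⊔ ℓ)
  IsRotationGroup n σ = RotRelations n σ × IntersectionProperty n σ

  -- an automorphism of ⟨σ⟩ with σ_1 ↦ σ_1⁻¹, σ_2 ↦ σ_1² σ_2,
  -- σ_i ↦ σ_i (i ≥ 3): exists iff the polytope is (directly) regular
  Reversible : (n : ℕ) → (ℕ → Carrier) → Set (c ⊔ ℓ)
  Reversible n σ = Σ[ φ ∈ (Carrier → Carrier) ]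
      ((x y : Carrier) → InRot n σ x → InRot n σ y → x ≈ y → φ x ≈ φ y)
    × ((x : Carrier) → InRot n σ x → InRot n σ (φ x))
    × ((x y : Carrier) → InRot n σ x → InRot n σ y → φ (x ∙ y) ≈ φ x ∙ φ y)
    × ((x y : Carrier) → InRot n σ x → InRot n σ y → φ x ≈ φ y → x ≈ y)
    × ((y : Carrier) → InRot n σ y → Σ[ x ∈ Carrier ] (InRot n σ x × φ x ≈ y))
    × (1 < n → φ (σ 1) ≈ σ 1 ⁻¹)
    × (2 < n → φ (σ 2) ≈ (σ 1 ∙ σ 1) ∙ σ 2)
    × ((i : ℕ) → 3 ≤ i → i < n → φ (σ i) ≈ σ i)

  ChiralRot : (n : ℕ) → (ℕ → Carrier) → Set (c ⊔ ℓ)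
  ChiralRot n σ = IsRotationGroup n σ × ¬ Reversible n σ

  ChiralPolytopeGroup : (n : ℕ) → (ℕ → Carrier) → Set (c ⊔ ℓ)
  ChiralPolytopeGroup n σ = ((x : Carrier) → InRot n σ x) × ChiralRot n σ

  RIdx : (n : ℕ) → Subset n → Set
  RIdx n I = Σ[ i ∈ ℕ ] (i ∈ℕ I)

  rotOf : (ℕ → Carrier) → ℕ → Carrier
  rotOf ρ i = ρ (i ∸ 1) ∙ ρ i

  StringCGroup : (n : ℕ) → (ℕ → Carrier) → Set (c ⊔ ℓ)
  StringCGroup n ρ =
      ((x : Carrier) → Gen {Σ[ i ∈ ℕ ] (i < n)} (λ a → ρ (proj₁ a)) x)
    × ((i : ℕ) → i < n → ρ i ∙ ρ i ≈ ε)
    × ((i : ℕ) → i < n → ¬ (ρ i ≈ ε))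
    × ((i j : ℕ) → i < n → j < n → (2 + i ≤ j ⊎ 2 + j ≤ i) →
         (ρ i ∙ ρ j) ∙ (ρ i ∙ ρ j) ≈ ε)
    × ((I J : Subset n) (x : Carrier) →
         Gen {RIdx n I} (λ a → ρ (proj₁ a)) x →
         Gen {RIdx n J} (λ a → ρ (proj₁ a)) x →
         Gen {RIdx n (I ∩ J)} (λ a → ρ (proj₁ a)) x)

  -- (G, ρ) is Γ(Q) for a directly regular n-polytope Q:
  -- Γ⁺(Q) = ⟨σ'_i⟩ has index 2 in G
  DirectlyRegularGroup : (n : ℕ) → (ℕ → Carrier) → Set (c ⊔ ℓ)
  DirectlyRegularGroup n ρ = StringCGroup n ρ
    × Σ[ g ∈ Carrier ] (¬ InRot n (rotOf ρ) g
        × ((x : Carrier) → InRot n (rotOf ρ) x ⊎ InRot n (rotOf ρ) (g ⁻¹ ∙ x)))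

  IsSubgroup : {k : Level} → (Carrier → Set k) → Set (c ⊔ ℓ ⊔ k)
  IsSubgroup K = ((x y : Carrier) → x ≈ y → K x → K y) × K ε
    × ((x y : Carrier) → K x → K y → K (x ∙ y))
    × ((x : Carrier) → K x → K (x ⁻¹))

  IsNormalSubgroupOf : {k : Level} → (Carrier → Set k) → (Carrier → Set k) → Set (c ⊔ ℓ ⊔ k)
  IsNormalSubgroupOf N K = IsSubgroup N × ((x : Carrier) → N x → K x)
    × ((g x : Carrier) → K g → N x → N ((g ∙ x) ∙ g ⁻¹))

-- K / N ≅ B, via a map on K inducing a bijective homomorphism on cosets
module _ {c ℓ c' ℓ' : Level} (A : Group c ℓ) (B : Group c' ℓ') where
  private
    module A = Group A
    module B = Group B

  QuotientIso : {k : Level} → (A.Carrier → Set k) → (A.Carrier → Set k) → Set (c ⊔ k ⊔ c' ⊔ ℓ')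
  QuotientIso K N = Σ[ f ∈ (A.Carrier → B.Carrier) ]
      ((x y : A.Carrier) → K x → K y → N (x A.⁻¹ A.∙ y) → f x B.≈ f y)
    × ((x y : A.Carrier) → K x → K y → f (x A.∙ y) B.≈ f x B.∙ f y)
    × ((x y : A.Carrier) → K x → K y → f x B.≈ f y → N (x A.⁻¹ A.∙ y))
    × ((b : B.Carrier) → Σ[ x ∈ A.Carrier ] (K x × f x B.≈ b))

  HasSubgroupWithQuotient : (k : Level) → {s : Level} → (A.Carrier → Set s) →
    Set (Level.suc k ⊔ c ⊔ ℓ ⊔ c' ⊔ ℓ' ⊔ s)
  HasSubgroupWithQuotient k S = Σ[ K ∈ (A.Carrier → Set k) ] Σ[ N ∈ (A.Carrier → Set k) ]
      ((x : A.Carrier) → K x → S x) × IsSubgroup A K × IsNormalSubgroupOf A N K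
    × QuotientIso K N

-- The Coxeter group W = ⟨r_0,…,r_{n-1} | r_i², (r_i r_j)² (|i-j| ≥ 2)⟩
-- as words modulo the congruence generated by the relators.

WWord : ℕ → Set
WWord n = List (Fin n)

data WStep (n : ℕ) : WWord n → WWord n → Set where
  invol : (u w : WWord n) (i : Fin n) → WStep n (u ++ i ∷ i ∷ w) (u ++ w)
  comm  : (u w : WWord n) (i j : Fin n) → (2 + toℕ i ≤ toℕ j ⊎ 2 + toℕ j ≤ toℕ i) →
          WStep n (u ++ i ∷ j ∷ i ∷ j ∷ w) (u ++ w)

_≈W_ : {n : ℕ} → WWord n → WWord n → Set
_≈W_ {n} = EqClosure (WStep n)

module _ {c ℓ : Level} (G : Group c ℓ) where
  open Group G

  -- s_i = r_{i-1} r_i, s_i⁻¹ = r_i r_{i-1}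
  sLetter : {n : ℕ} → SIdx G n × Bool → WWord n
  sLetter ((i , _ , p) , false) = fromℕ< (≤-<-trans (m∸n≤m i 1) p) ∷ fromℕ< p ∷ []
  sLetter ((i , _ , p) , true) = fromℕ< p ∷ fromℕ< (≤-<-trans (m∸n≤m i 1) p) ∷ []

  sExpand : {n : ℕ} → List (SIdx G n × Bool) → WWord n
  sExpand = concatMap sLetter

  InWplus : {n : ℕ} → WWord n → Set
  InWplus {n} w = Σ[ u ∈ List (SIdx G n × Bool) ] sExpand u ≈W w

  -- w ∈ M = ker(W⁺ → Γ(P), s_i ↦ σ_i)
  InM : (n : ℕ) → (ℕ → Carrier) → WWord n → Set ℓ
  InM n σ w = Σ[ u ∈ List (SIdx G n × Bool) ]
    (sExpand u ≈W w × eval G (λ a → σ (proj₁ a)) u ≈ ε)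

  -- M · r_0 M r_0⁻¹ = W⁺ (the inclusion ⊆ is automatic; r_0⁻¹ = r_0)
  TotallyChiral : (n : ℕ) → (ℕ → Carrier) → Set ℓ
  TotallyChiral n σ = (z : 0 < n) → (w : WWord n) → InWplus w →
    Σ[ m ∈ WWord n ] Σ[ m' ∈ WWord n ]
      (InM n σ m × InM n σ m' × w ≈W (m ++ fromℕ< z ∷ m' ++ [ fromℕ< z ]))

_×G_ : {c ℓ c' ℓ' : Level} → Group c ℓ → Group c' ℓ' → Group (c ⊔ c') (ℓ ⊔ ℓ')
_×G_ = DP.group

mixGens : {c ℓ c' ℓ' : Level} (G : Group c ℓ) (H : Group c' ℓ') →
  (ℕ → Group.Carrier G) → (ℕ → Group.Carrier H) → ℕ → Group.Carrier (G ×G H)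
mixGens G H σ ρ j = σ j , rotOf H ρ j

-- Write τⱼ = (σⱼ, σ′ⱼ) for the generators of the mix K.  The rotation relations hold in each
-- coordinate, so the only thing to show is that K is not reversible.  If φ were the reversing
-- automorphism of K, then x ↦ (x₁, φ(x)₁) would be a homomorphism from K onto Γ(P) × Γ(P),
-- contradicting the hypothesis.  Surjectivity is where total chirality enters: letting rᵢ act on K
-- by x ↦ (τ₁⋯τᵢ)⁻¹ φ(x) respects the Coxeter relations of W and sends sᵢ = rᵢ₋₁rᵢ to τᵢ, with r₀
-- acting as φ; so a factorisation m r₀ m′ r₀ with m, m′ ∈ M of the W⁺-word of y⁻¹φ(z) gives
-- y⁻¹φ(z) = μ φ(μ′) with μ₁ = μ′₁ = 1, and then x = yμ satisfies x₁ = y₁ and φ(x)₁ = z₁.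

module Submission where

open import Defs
open import Level using (Level; Lift; lift; lower; _⊔_)
open import Algebra.Bundles using (Group)
open import Data.Bool using (Bool; true; false; not)
open import Data.Empty using (⊥-elim)
open import Data.Fin using (fromℕ<; toℕ)
open import Data.Fin.Properties using (toℕ-fromℕ<; toℕ<n)
open import Data.List using (List; []; _∷_; _++_; [_])
open import Data.List.Properties using (++-assoc; ++-identityʳ)
open import Data.Nat using (ℕ; zero; suc; _≤_; _<_; _∸_; _+_; s≤s; z≤n; _<?_)
open import Data.Nat.Properties
  using (+-suc; +-identityʳ; m+n∸m≡n; m+[n∸m]≡n; m∸n≤m; m<m+n; <-trans; <⇒≤; n<1+n; ≤-<-trans; m≤n⇒∃[o]m+o≡n)
open import Data.Product using (Σ-syntax; _×_; _,_; proj₁; proj₂)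
open import Data.Sum using (_⊎_; inj₁; inj₂)
open import Relation.Nullary using (¬_; yes; no)
open import Relation.Binary.PropositionalEquality as ≡ using (_≡_)
import Relation.Binary.Construct.Closure.Equivalence as EqClosure

WStep-++ʳ : ∀ {n} (z : WWord n) {x y : WWord n} → WStep n x y → WStep n (x ++ z) (y ++ z)
WStep-++ʳ z (invol u w i)
  rewrite ++-assoc u (i ∷ i ∷ w) z | ++-assoc u w z = invol u (w ++ z) i
WStep-++ʳ z (comm u w i j apart)
  rewrite ++-assoc u (i ∷ j ∷ i ∷ j ∷ w) z | ++-assoc u w z = comm u (w ++ z) i j apart

≈W-++ʳ : ∀ {n} (z : WWord n) {x y : WWord n} → x ≈W y → (x ++ z) ≈W (y ++ z)
≈W-++ʳ z = EqClosure.gmap (_++ z) (WStep-++ʳ z)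

module Words {c ℓ : Level} (G : Group c ℓ) where
  open Group G
  open import Algebra.Properties.Group G using (ε⁻¹≈ε; ⁻¹-anti-homo-∙; ⁻¹-involutive)
  open import Relation.Binary.Reasoning.Setoid setoid

  module _ {A : Set} (f : A → Carrier) where

    eval-++ : ∀ u v → eval G f (u ++ v) ≈ eval G f u ∙ eval G f v
    eval-++ [] v = sym (identityˡ _)
    eval-++ ((a , false) ∷ u) v = trans (∙-congˡ (eval-++ u v)) (sym (assoc _ _ _))
    eval-++ ((a , true) ∷ u) v = trans (∙-congˡ (eval-++ u v)) (sym (assoc _ _ _))

    invert : List (A × Bool) → List (A × Bool)
    invert [] = []
    invert ((a , b) ∷ w) = invert w ++ [ (a , not b) ]

    eval-invert : ∀ w → eval G f (invert w) ≈ eval G f w ⁻¹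
    eval-invert [] = sym ε⁻¹≈ε
    eval-invert ((a , false) ∷ w) = begin
      eval G f (invert w ++ [ (a , true) ]) ≈⟨ eval-++ (invert w) _ ⟩
      eval G f (invert w) ∙ (f a ⁻¹ ∙ ε)    ≈⟨ ∙-cong (eval-invert w) (identityʳ _) ⟩
      eval G f w ⁻¹ ∙ f a ⁻¹                ≈⟨ ⁻¹-anti-homo-∙ _ _ ⟨
      (f a ∙ eval G f w) ⁻¹                 ∎
    eval-invert ((a , true) ∷ w) = begin
      eval G f (invert w ++ [ (a , false) ]) ≈⟨ eval-++ (invert w) _ ⟩
      eval G f (invert w) ∙ (f a ∙ ε)        ≈⟨ ∙-cong (eval-invert w) (trans (identityʳ _) (sym (⁻¹-involutive _))) ⟩
      eval G f w ⁻¹ ∙ f a ⁻¹ ⁻¹              ≈⟨ ⁻¹-anti-homo-∙ _ _ ⟨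
      (f a ⁻¹ ∙ eval G f w) ⁻¹               ∎

    Gen-resp : ∀ {x y} → x ≈ y → Gen G f x → Gen G f y
    Gen-resp x≈y (w , e) = w , trans e x≈y

    Gen-ε : Gen G f ε
    Gen-ε = [] , refl

    Gen-∙ : ∀ {x y} → Gen G f x → Gen G f y → Gen G f (x ∙ y)
    Gen-∙ (u , e) (v , e′) = u ++ v , trans (eval-++ u v) (∙-cong e e′)

    Gen-⁻¹ : ∀ {x} → Gen G f x → Gen G f (x ⁻¹)
    Gen-⁻¹ (u , e) = invert u , trans (eval-invert u) (⁻¹-cong e)

    Gen-generator : ∀ a → Gen G f (f a)
    Gen-generator a = [ (a , false) ] , identityʳ _

    Gen-empty : ¬ A → ∀ {x} → Gen G f x → x ≈ ε
    Gen-empty ¬a ([] , e) = sym e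
    Gen-empty ¬a ((a , _) ∷ _ , _) = ⊥-elim (¬a a)

module _ {c₁ ℓ₁ c₂ ℓ₂ : Level} (G : Group c₁ ℓ₁) (H : Group c₂ ℓ₂) where
  private
    module G = Group G
    module H = Group H

  module _ {A : Set} (f : A → G.Carrier) (g : A → H.Carrier) where

    proj₁-eval : ∀ w → proj₁ (eval (G ×G H) (λ a → f a , g a) w) ≡ eval G f w
    proj₁-eval [] = ≡.refl
    proj₁-eval ((a , false) ∷ w) = ≡.cong (f a G.∙_) (proj₁-eval w)
    proj₁-eval ((a , true) ∷ w) = ≡.cong (f a G.⁻¹ G.∙_) (proj₁-eval w)

    proj₂-eval : ∀ w → proj₂ (eval (G ×G H) (λ a → f a , g a) w) ≡ eval H g w
    proj₂-eval [] = ≡.refl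
    proj₂-eval ((a , false) ∷ w) = ≡.cong (g a H.∙_) (proj₂-eval w)
    proj₂-eval ((a , true) ∷ w) = ≡.cong (g a H.⁻¹ H.∙_) (proj₂-eval w)

  module _ (σ : ℕ → G.Carrier) (σ′ : ℕ → H.Carrier) where

    proj₁-prodFrom : ∀ i k → proj₁ (prodFrom (G ×G H) (λ j → σ j , σ′ j) i k) ≡ prodFrom G σ i k
    proj₁-prodFrom i zero = ≡.refl
    proj₁-prodFrom i (suc k) = ≡.cong (G._∙ σ (suc (i + k))) (proj₁-prodFrom i k)

    proj₂-prodFrom : ∀ i k → proj₂ (prodFrom (G ×G H) (λ j → σ j , σ′ j) i k) ≡ prodFrom H σ′ i k
    proj₂-prodFrom i zero = ≡.refl
    proj₂-prodFrom i (suc k) = ≡.cong (H._∙ σ′ (suc (i + k))) (proj₂-prodFrom i k)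

    ×-RotRelations : ∀ {n} → RotRelations G n σ → RotRelations H n σ′ →
                     RotRelations (G ×G H) n (λ j → σ j , σ′ j)
    ×-RotRelations rG rH i j 1≤i i<j j<n =
        ≡.subst (λ t → t G.∙ t G.≈ G.ε) (≡.sym (proj₁-prodFrom i (j ∸ i))) (rG i j 1≤i i<j j<n)
      , ≡.subst (λ t → t H.∙ t H.≈ H.ε) (≡.sym (proj₂-prodFrom i (j ∸ i))) (rH i j 1≤i i<j j<n)

module _ {c ℓ : Level} (H : Group c ℓ) where
  open Group H
  open import Algebra.Properties.Monoid monoid using (cancelᶜ)
  open import Relation.Binary.Reasoning.Setoid setoid

  rotOf-prodFrom : ∀ {n} (ρ : ℕ → Carrier) → (∀ i → i < n → ρ i ∙ ρ i ≈ ε) →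
                   ∀ i k → i + k < n → prodFrom H (rotOf H ρ) i k ≈ ρ (i ∸ 1) ∙ ρ (i + k)
  rotOf-prodFrom ρ involution i zero _ = ∙-congˡ (reflexive (≡.cong ρ (≡.sym (+-identityʳ i))))
  rotOf-prodFrom {n} ρ involution i (suc k) i+k+1<n = begin
    prodFrom H (rotOf H ρ) i k ∙ (ρ (i + k) ∙ ρ (suc (i + k)))
      ≈⟨ ∙-congʳ (rotOf-prodFrom ρ involution i k i+k<n) ⟩
    (ρ (i ∸ 1) ∙ ρ (i + k)) ∙ (ρ (i + k) ∙ ρ (suc (i + k)))
      ≈⟨ cancelᶜ (involution (i + k) i+k<n) _ _ ⟩
    ρ (i ∸ 1) ∙ ρ (suc (i + k))
      ≡⟨ ≡.cong (λ t → ρ (i ∸ 1) ∙ ρ t) (+-suc i k) ⟨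
    ρ (i ∸ 1) ∙ ρ (i + suc k) ∎
    where
    i+k<n : i + k < n
    i+k<n = <-trans (n<1+n _) (≡.subst (_< n) (+-suc i k) i+k+1<n)

  rotOf-RotRelations : ∀ {n} {ρ : ℕ → Carrier} → StringCGroup H n ρ → RotRelations H n (rotOf H ρ)
  rotOf-RotRelations {n} {ρ} (_ , involution , _ , commuting , _) (suc i) j _ i<j j<n =
    trans (∙-cong κ≈ρᵢρⱼ κ≈ρᵢρⱼ) (commuting i j (<-trans (n<1+n i) (<-trans i<j j<n)) j<n (inj₁ i<j))
    where
    i+[j∸i]≡j : suc i + (j ∸ suc i) ≡ j
    i+[j∸i]≡j = m+[n∸m]≡n (<⇒≤ i<j)
    κ≈ρᵢρⱼ : κ H (rotOf H ρ) (suc i) j ≈ ρ i ∙ ρ j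
    κ≈ρᵢρⱼ = trans (rotOf-prodFrom ρ involution (suc i) (j ∸ suc i) (≡.subst (_< n) (≡.sym i+[j∸i]≡j) j<n))
                   (∙-congˡ (reflexive (≡.cong ρ i+[j∸i]≡j)))

module Reversal {c ℓ : Level} (A : Group c ℓ) (n : ℕ) (τ : ℕ → Group.Carrier A)
                (rev : Reversible A n τ) where
  open Group A
  open import Algebra.Properties.Group A
    using (⁻¹-involutive; inverseˡ-unique; identityˡ-unique; x≈z//y; \\-leftDividesˡ; \\-leftDividesʳ)
  open Words A
  open import Relation.Binary.Reasoning.Setoid setoid

  R : Carrier → Set ℓ
  R = InRot A n τ

  τ̂ : SIdx A n → Carrier
  τ̂ a = τ (proj₁ a)

  R-generator : ∀ {i} → 1 ≤ i → i < n → R (τ i)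
  R-generator {i} 1≤i i<n = Gen-generator τ̂ (i , 1≤i , i<n)

  φ : Carrier → Carrier
  φ = proj₁ rev

  φ-cong : ∀ {x y} → R x → R y → x ≈ y → φ x ≈ φ y
  φ-cong = proj₁ (proj₂ rev) _ _

  φ-R : ∀ {x} → R x → R (φ x)
  φ-R = proj₁ (proj₂ (proj₂ rev)) _

  φ-∙ : ∀ {x y} → R x → R y → φ (x ∙ y) ≈ φ x ∙ φ y
  φ-∙ = proj₁ (proj₂ (proj₂ (proj₂ rev))) _ _

  φ-τ₁ : 1 < n → φ (τ 1) ≈ τ 1 ⁻¹
  φ-τ₁ = proj₁ (proj₂ (proj₂ (proj₂ (proj₂ (proj₂ (proj₂ rev))))))

  φ-τ₂ : 2 < n → φ (τ 2) ≈ (τ 1 ∙ τ 1) ∙ τ 2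
  φ-τ₂ = proj₁ (proj₂ (proj₂ (proj₂ (proj₂ (proj₂ (proj₂ (proj₂ rev)))))))

  φ-τ₃₊ : ∀ i → 3 ≤ i → i < n → φ (τ i) ≈ τ i
  φ-τ₃₊ = proj₂ (proj₂ (proj₂ (proj₂ (proj₂ (proj₂ (proj₂ (proj₂ rev)))))))

  φ-ε : φ ε ≈ ε
  φ-ε = identityˡ-unique (φ ε) (φ ε) (begin
    φ ε ∙ φ ε ≈⟨ φ-∙ Gen-ε′ Gen-ε′ ⟨
    φ (ε ∙ ε) ≈⟨ φ-cong (Gen-∙ τ̂ Gen-ε′ Gen-ε′) Gen-ε′ (identityˡ ε) ⟩
    φ ε       ∎)
    where Gen-ε′ = Gen-ε τ̂

  φ-⁻¹ : ∀ {x} → R x → φ (x ⁻¹) ≈ φ x ⁻¹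
  φ-⁻¹ {x} r = inverseˡ-unique (φ (x ⁻¹)) (φ x) (begin
    φ (x ⁻¹) ∙ φ x ≈⟨ φ-∙ r⁻¹ r ⟨
    φ (x ⁻¹ ∙ x)   ≈⟨ φ-cong (Gen-∙ τ̂ r⁻¹ r) (Gen-ε τ̂) (inverseˡ x) ⟩
    φ ε            ≈⟨ φ-ε ⟩
    ε              ∎)
    where r⁻¹ = Gen-⁻¹ τ̂ r

  φ²-∙ : ∀ {x y} → R x → R y → φ (φ (x ∙ y)) ≈ φ (φ x) ∙ φ (φ y)
  φ²-∙ r s = trans (φ-cong (φ-R (Gen-∙ τ̂ r s)) (Gen-∙ τ̂ (φ-R r) (φ-R s)) (φ-∙ r s))
                   (φ-∙ (φ-R r) (φ-R s))

  φ²-⁻¹ : ∀ {x} → R x → φ (φ (x ⁻¹)) ≈ φ (φ x) ⁻¹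
  φ²-⁻¹ r = trans (φ-cong (φ-R (Gen-⁻¹ τ̂ r)) (Gen-⁻¹ τ̂ (φ-R r)) (φ-⁻¹ r)) (φ-⁻¹ (φ-R r))

  φ²-generator : ∀ i → 1 ≤ i → i < n → φ (φ (τ i)) ≈ τ i
  φ²-generator 1 1≤i i<n = begin
    φ (φ (τ 1)) ≈⟨ φ-cong (φ-R τ₁) (Gen-⁻¹ τ̂ τ₁) (φ-τ₁ i<n) ⟩
    φ (τ 1 ⁻¹)  ≈⟨ φ-⁻¹ τ₁ ⟩
    φ (τ 1) ⁻¹  ≈⟨ ⁻¹-cong (φ-τ₁ i<n) ⟩
    τ 1 ⁻¹ ⁻¹   ≈⟨ ⁻¹-involutive _ ⟩
    τ 1         ∎
    where τ₁ = R-generator 1≤i i<n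
  φ²-generator 2 1≤i i<n = begin
    φ (φ (τ 2))                               ≈⟨ φ-cong (φ-R τ₂) τ₁τ₁τ₂ (φ-τ₂ i<n) ⟩
    φ ((τ 1 ∙ τ 1) ∙ τ 2)                     ≈⟨ φ-∙ τ₁τ₁ τ₂ ⟩
    φ (τ 1 ∙ τ 1) ∙ φ (τ 2)                   ≈⟨ ∙-cong (φ-∙ τ₁ τ₁) (φ-τ₂ i<n) ⟩
    (φ (τ 1) ∙ φ (τ 1)) ∙ ((τ 1 ∙ τ 1) ∙ τ 2) ≈⟨ ∙-congʳ (∙-cong (φ-τ₁ 1<n) (φ-τ₁ 1<n)) ⟩
    (τ 1 ⁻¹ ∙ τ 1 ⁻¹) ∙ ((τ 1 ∙ τ 1) ∙ τ 2)   ≈⟨ ∙-congˡ (assoc _ _ _) ⟩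
    (τ 1 ⁻¹ ∙ τ 1 ⁻¹) ∙ (τ 1 ∙ (τ 1 ∙ τ 2))   ≈⟨ assoc _ _ _ ⟩
    τ 1 ⁻¹ ∙ (τ 1 ⁻¹ ∙ (τ 1 ∙ (τ 1 ∙ τ 2)))   ≈⟨ ∙-congˡ (\\-leftDividesʳ _ _) ⟩
    τ 1 ⁻¹ ∙ (τ 1 ∙ τ 2)                      ≈⟨ \\-leftDividesʳ _ _ ⟩
    τ 2                                       ∎
    where
    1<n : 1 < n
    1<n = <-trans (n<1+n 1) i<n
    τ₁ = R-generator (s≤s z≤n) 1<n
    τ₂ = R-generator 1≤i i<n
    τ₁τ₁ = Gen-∙ τ̂ τ₁ τ₁
    τ₁τ₁τ₂ = Gen-∙ τ̂ τ₁τ₁ τ₂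
  φ²-generator (suc (suc (suc i))) 1≤i i<n =
    trans (φ-cong (φ-R τᵢ) τᵢ (φ-τ₃₊ _ 3≤i i<n)) (φ-τ₃₊ _ 3≤i i<n)
    where
    3≤i : 3 ≤ suc (suc (suc i))
    3≤i = s≤s (s≤s (s≤s z≤n))
    τᵢ = R-generator 1≤i i<n

  φ²-eval : ∀ w → φ (φ (eval A τ̂ w)) ≈ eval A τ̂ w
  φ²-eval [] = trans (φ-cong (φ-R (Gen-ε τ̂)) (Gen-ε τ̂) φ-ε) φ-ε
  φ²-eval (((i , 1≤i , i<n) , false) ∷ w) =
    trans (φ²-∙ (R-generator 1≤i i<n) (w , refl)) (∙-cong (φ²-generator i 1≤i i<n) (φ²-eval w))
  φ²-eval (((i , 1≤i , i<n) , true) ∷ w) =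
    trans (φ²-∙ (Gen-⁻¹ τ̂ τᵢ) (w , refl))
          (∙-cong (trans (φ²-⁻¹ τᵢ) (⁻¹-cong (φ²-generator i 1≤i i<n))) (φ²-eval w))
    where τᵢ = R-generator 1≤i i<n

  φ-involutive : ∀ {x} → R x → φ (φ x) ≈ x
  φ-involutive r@(w , e) =
    trans (φ-cong (φ-R r) (φ-R (w , refl)) (φ-cong r (w , refl) (sym e))) (trans (φ²-eval w) e)

  y⁻¹φz≈μφμ′⇒φ[yμ]≈zμ′⁻¹ : ∀ {y z μ μ′} → R y → R z → R μ → R μ′ →
                            y ⁻¹ ∙ φ z ≈ μ ∙ φ μ′ → φ (y ∙ μ) ≈ z ∙ μ′ ⁻¹
  y⁻¹φz≈μφμ′⇒φ[yμ]≈zμ′⁻¹ {y} {z} {μ} {μ′} Ry Rz Rμ Rμ′ decomposition = begin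
    φ (y ∙ μ)                ≈⟨ φ-cong (Gen-∙ τ̂ Ry Rμ) (Gen-∙ τ̂ (φ-R Rz) φμ′⁻¹) yμ≈ ⟩
    φ (φ z ∙ φ μ′ ⁻¹)        ≈⟨ φ-∙ (φ-R Rz) φμ′⁻¹ ⟩
    φ (φ z) ∙ φ (φ μ′ ⁻¹)    ≈⟨ ∙-cong (φ-involutive Rz) (φ-⁻¹ (φ-R Rμ′)) ⟩
    z ∙ φ (φ μ′) ⁻¹          ≈⟨ ∙-congˡ (⁻¹-cong (φ-involutive Rμ′)) ⟩
    z ∙ μ′ ⁻¹                ∎
    where
    φμ′⁻¹ = Gen-⁻¹ τ̂ (φ-R Rμ′)
    yμ≈ : y ∙ μ ≈ φ z ∙ φ μ′ ⁻¹
    yμ≈ = x≈z//y (y ∙ μ) (φ μ′) (φ z) (begin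
      (y ∙ μ) ∙ φ μ′       ≈⟨ assoc _ _ _ ⟩
      y ∙ (μ ∙ φ μ′)       ≈⟨ ∙-congˡ decomposition ⟨
      y ∙ (y ⁻¹ ∙ φ z)     ≈⟨ \\-leftDividesˡ y (φ z) ⟩
      φ z                  ∎)

module CoxeterAction {c ℓ : Level} (A : Group c ℓ) (n : ℕ) (τ : ℕ → Group.Carrier A)
                     (relations : RotRelations A n τ) (rev : Reversible A n τ) where
  open Group A
  open import Algebra.Properties.Group A
    using (ε⁻¹≈ε; ⁻¹-involutive; ⁻¹-anti-homo-∙; ⁻¹-anti-homo-\\; inverseˡ-unique; \\-leftDividesʳ)
  open import Algebra.Properties.Monoid monoid using (cancelˡ)
  open Words A
  open Reversal A n τ rev
  open import Relation.Binary.Reasoning.Setoid setoid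

  R-prodFrom : ∀ i k → 1 ≤ i → i + k < n → R (prodFrom A τ i k)
  R-prodFrom i zero 1≤i i<n = R-generator 1≤i (≡.subst (_< n) (+-identityʳ i) i<n)
  R-prodFrom i (suc k) 1≤i i+k+1<n =
    Gen-∙ τ̂ (R-prodFrom i k 1≤i (<-trans (n<1+n _) last<n)) (R-generator (s≤s z≤n) last<n)
    where
    last<n : suc (i + k) < n
    last<n = ≡.subst (_< n) (+-suc i k) i+k+1<n

  prodFrom-involutive : ∀ i k → 1 ≤ i → i + suc k < n →
                        prodFrom A τ i (suc k) ∙ prodFrom A τ i (suc k) ≈ ε
  prodFrom-involutive i k 1≤i i+k+1<n =
    ≡.subst (λ t → prodFrom A τ i t ∙ prodFrom A τ i t ≈ ε) (m+n∸m≡n i (suc k))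
            (relations i (i + suc k) 1≤i (m<m+n i (s≤s z≤n)) i+k+1<n)

  prefix : ℕ → Carrier
  prefix zero = ε
  prefix (suc k) = prodFrom A τ 1 k

  prefix-suc : ∀ j → prefix (suc j) ≈ prefix j ∙ τ (suc j)
  prefix-suc zero = sym (identityˡ _)
  prefix-suc (suc j) = refl

  R-prefix : ∀ j → j < n → R (prefix j)
  R-prefix zero _ = Gen-ε τ̂
  R-prefix (suc k) k<n = R-prodFrom 1 k (s≤s z≤n) k<n

  φ-prefix₂₊ : ∀ k → 2 + k < n → φ (prefix (2 + k)) ≈ prefix (2 + k)
  φ-prefix₂₊ zero 2<n = begin
    φ (τ 1 ∙ τ 2)                 ≈⟨ φ-∙ τ₁ (R-generator (s≤s z≤n) 2<n) ⟩
    φ (τ 1) ∙ φ (τ 2)             ≈⟨ ∙-cong (φ-τ₁ 1<n) (φ-τ₂ 2<n) ⟩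
    τ 1 ⁻¹ ∙ ((τ 1 ∙ τ 1) ∙ τ 2)  ≈⟨ ∙-congˡ (assoc _ _ _) ⟩
    τ 1 ⁻¹ ∙ (τ 1 ∙ (τ 1 ∙ τ 2))  ≈⟨ \\-leftDividesʳ _ _ ⟩
    τ 1 ∙ τ 2                     ∎
    where
    1<n : 1 < n
    1<n = <-trans (n<1+n 1) 2<n
    τ₁ = R-generator (s≤s z≤n) 1<n
  φ-prefix₂₊ (suc k) 3+k<n =
    trans (φ-∙ (R-prefix (2 + k) 2+k<n) (R-generator (s≤s z≤n) 3+k<n))
          (∙-cong (φ-prefix₂₊ k 2+k<n) (φ-τ₃₊ _ (s≤s (s≤s (s≤s z≤n))) 3+k<n))
    where
    2+k<n : 2 + k < n
    2+k<n = <-trans (n<1+n _) 3+k<n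

  φ-prefix⁻¹ : ∀ j → j < n → φ (prefix j ⁻¹) ≈ prefix j
  φ-prefix⁻¹ zero _ = trans (φ-cong (Gen-⁻¹ τ̂ (Gen-ε τ̂)) (Gen-ε τ̂) ε⁻¹≈ε) φ-ε
  φ-prefix⁻¹ (suc zero) 1<n =
    trans (φ-⁻¹ τ₁) (trans (⁻¹-cong (φ-τ₁ 1<n)) (⁻¹-involutive _))
    where τ₁ = R-generator (s≤s z≤n) 1<n
  φ-prefix⁻¹ (suc (suc k)) 2+k<n =
    trans (φ-cong (Gen-⁻¹ τ̂ P) P P⁻¹≈P) (φ-prefix₂₊ k 2+k<n)
    where
    P = R-prefix (2 + k) 2+k<n
    P⁻¹≈P : prefix (2 + k) ⁻¹ ≈ prefix (2 + k)
    P⁻¹≈P = sym (inverseˡ-unique _ _ (prodFrom-involutive 1 k (s≤s z≤n) 2+k<n))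

  δ : ℕ → ℕ → Carrier
  δ i j = prefix i ⁻¹ ∙ prefix j

  δ-pred : ∀ i → 1 ≤ i → δ (i ∸ 1) i ≈ τ i
  δ-pred (suc i) _ = trans (∙-congˡ (prefix-suc i)) (\\-leftDividesʳ _ _)

  δ-telescope : ∀ i k → δ i (suc (i + k)) ≈ prodFrom A τ (suc i) k
  δ-telescope i zero =
    trans (∙-congˡ (reflexive (≡.cong (λ j → prefix (suc j)) (+-identityʳ i)))) (δ-pred (suc i) (s≤s z≤n))
  δ-telescope i (suc k) = begin
    prefix i ⁻¹ ∙ prefix (suc (i + suc k))
      ≡⟨ ≡.cong (λ j → prefix i ⁻¹ ∙ prefix (suc j)) (+-suc i k) ⟩
    prefix i ⁻¹ ∙ (prefix (suc (i + k)) ∙ τ (suc (suc (i + k))))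
      ≈⟨ assoc _ _ _ ⟨
    δ i (suc (i + k)) ∙ τ (suc (suc (i + k)))
      ≈⟨ ∙-congʳ (δ-telescope i k) ⟩
    prodFrom A τ (suc i) (suc k) ∎

  δ-involutive : ∀ i j → 2 + i ≤ j → j < n → δ i j ∙ δ i j ≈ ε
  δ-involutive i j 2+i≤j j<n with m≤n⇒∃[o]m+o≡n 2+i≤j
  ... | o , ≡.refl = trans (∙-cong δ≈κ δ≈κ) (prodFrom-involutive (suc i) o (s≤s z≤n) lt)
    where
    j≡ : suc (suc (i + o)) ≡ suc (i + suc o)
    j≡ = ≡.cong suc (≡.sym (+-suc i o))
    lt : suc (i + suc o) < n
    lt = ≡.subst (_< n) j≡ j<n
    δ≈κ : δ i (2 + i + o) ≈ prodFrom A τ (suc i) (suc o)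
    δ≈κ = trans (reflexive (≡.cong (δ i) j≡)) (δ-telescope i (suc o))

  δ-involutive-apart : ∀ {i j} → (2 + i ≤ j ⊎ 2 + j ≤ i) → i < n → j < n → δ i j ∙ δ i j ≈ ε
  δ-involutive-apart {i} {j} (inj₁ 2+i≤j) _ j<n = δ-involutive i j 2+i≤j j<n
  δ-involutive-apart {i} {j} (inj₂ 2+j≤i) i<n _ = begin
    δ i j ∙ δ i j             ≈⟨ ∙-cong δ-swap δ-swap ⟩
    δ j i ⁻¹ ∙ δ j i ⁻¹       ≈⟨ ⁻¹-anti-homo-∙ _ _ ⟨
    (δ j i ∙ δ j i) ⁻¹        ≈⟨ ⁻¹-cong (δ-involutive j i 2+j≤i i<n) ⟩
    ε ⁻¹                      ≈⟨ ε⁻¹≈ε ⟩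
    ε                         ∎
    where
    δ-swap : δ i j ≈ δ j i ⁻¹
    δ-swap = sym (⁻¹-anti-homo-\\ (prefix j) (prefix i))

  -- Modelled on a regular polytope, where prefix j = ρ₀ρⱼ and φ is conjugation by ρ₀:
  -- there ι w is the image of the word w times ρ₀^(length w).
  ι : WWord n → Carrier
  ι [] = ε
  ι (i ∷ w) = prefix (toℕ i) ⁻¹ ∙ φ (ι w)

  R-ι : ∀ w → R (ι w)
  R-ι [] = Gen-ε τ̂
  R-ι (i ∷ w) = Gen-∙ τ̂ (Gen-⁻¹ τ̂ (R-prefix _ (toℕ<n i))) (φ-R (R-ι w))

  ι-pair : ∀ i j w → ι (i ∷ j ∷ w) ≈ δ (toℕ i) (toℕ j) ∙ ι w
  ι-pair i j w = begin
    prefix (toℕ i) ⁻¹ ∙ φ (prefix (toℕ j) ⁻¹ ∙ φ (ι w))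
      ≈⟨ ∙-congˡ (φ-∙ (Gen-⁻¹ τ̂ (R-prefix _ (toℕ<n j))) (φ-R (R-ι w))) ⟩
    prefix (toℕ i) ⁻¹ ∙ (φ (prefix (toℕ j) ⁻¹) ∙ φ (φ (ι w)))
      ≈⟨ ∙-congˡ (∙-cong (φ-prefix⁻¹ _ (toℕ<n j)) (φ-involutive (R-ι w))) ⟩
    prefix (toℕ i) ⁻¹ ∙ (prefix (toℕ j) ∙ ι w)
      ≈⟨ assoc _ _ _ ⟨
    δ (toℕ i) (toℕ j) ∙ ι w ∎

  ι-congˡ : ∀ u {v v′} → ι v ≈ ι v′ → ι (u ++ v) ≈ ι (u ++ v′)
  ι-congˡ [] e = e
  ι-congˡ (i ∷ u) {v} {v′} e = ∙-congˡ (φ-cong (R-ι (u ++ v)) (R-ι (u ++ v′)) (ι-congˡ u e))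

  ι-step : ∀ {x y} → WStep n x y → ι x ≈ ι y
  ι-step (invol u w i) = ι-congˡ u (trans (ι-pair i i w) (trans (∙-congʳ (inverseˡ _)) (identityˡ _)))
  ι-step (comm u w i j apart) = ι-congˡ u (begin
    ι (i ∷ j ∷ i ∷ j ∷ w)  ≈⟨ ι-pair i j (i ∷ j ∷ w) ⟩
    δᵢⱼ ∙ ι (i ∷ j ∷ w)    ≈⟨ ∙-congˡ (ι-pair i j w) ⟩
    δᵢⱼ ∙ (δᵢⱼ ∙ ι w)      ≈⟨ cancelˡ (δ-involutive-apart apart (toℕ<n i) (toℕ<n j)) _ ⟩
    ι w                    ∎)
    where δᵢⱼ = δ (toℕ i) (toℕ j)

  ι-resp : ∀ {x y} → x ≈W y → ι x ≈ ι y
  ι-resp = EqClosure.gfold isEquivalence ι ι-step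

  module _ {c′ ℓ′ : Level} (B : Group c′ ℓ′) where

    ι-sExpand-++ : ∀ t w → ι (sExpand B t ++ w) ≈ eval A τ̂ t ∙ ι w
    ι-sExpand-++ [] w = sym (identityˡ _)
    ι-sExpand-++ (((i , 1≤i , i<n) , false) ∷ t) w = begin
      ι (fromℕ< i∸1<n ∷ fromℕ< i<n ∷ sExpand B t ++ w)
        ≈⟨ ι-pair (fromℕ< i∸1<n) (fromℕ< i<n) (sExpand B t ++ w) ⟩
      δ (toℕ (fromℕ< i∸1<n)) (toℕ (fromℕ< i<n)) ∙ ι (sExpand B t ++ w)
        ≈⟨ ∙-cong (reflexive (≡.cong₂ δ (toℕ-fromℕ< i∸1<n) (toℕ-fromℕ< i<n))) (ι-sExpand-++ t w) ⟩
      δ (i ∸ 1) i ∙ (eval A τ̂ t ∙ ι w)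
        ≈⟨ ∙-congʳ (δ-pred i 1≤i) ⟩
      τ i ∙ (eval A τ̂ t ∙ ι w)
        ≈⟨ assoc _ _ _ ⟨
      (τ i ∙ eval A τ̂ t) ∙ ι w ∎
      where i∸1<n = ≤-<-trans (m∸n≤m i 1) i<n
    ι-sExpand-++ (((i , 1≤i , i<n) , true) ∷ t) w = begin
      ι (fromℕ< i<n ∷ fromℕ< i∸1<n ∷ sExpand B t ++ w)
        ≈⟨ ι-pair (fromℕ< i<n) (fromℕ< i∸1<n) (sExpand B t ++ w) ⟩
      δ (toℕ (fromℕ< i<n)) (toℕ (fromℕ< i∸1<n)) ∙ ι (sExpand B t ++ w)
        ≈⟨ ∙-cong (reflexive (≡.cong₂ δ (toℕ-fromℕ< i<n) (toℕ-fromℕ< i∸1<n))) (ι-sExpand-++ t w) ⟩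
      δ i (i ∸ 1) ∙ (eval A τ̂ t ∙ ι w)
        ≈⟨ ∙-congʳ (trans (sym (⁻¹-anti-homo-\\ _ _)) (⁻¹-cong (δ-pred i 1≤i))) ⟩
      τ i ⁻¹ ∙ (eval A τ̂ t ∙ ι w)
        ≈⟨ assoc _ _ _ ⟨
      (τ i ⁻¹ ∙ eval A τ̂ t) ∙ ι w ∎
      where i∸1<n = ≤-<-trans (m∸n≤m i 1) i<n

    ι-sExpand : ∀ t → ι (sExpand B t) ≈ eval A τ̂ t
    ι-sExpand t = trans (reflexive (≡.cong ι (≡.sym (++-identityʳ (sExpand B t)))))
                        (trans (ι-sExpand-++ t []) (identityʳ _))

    r₀-decomposition : (0<n : 0 < n) {m m′ : WWord n} (t u u′ : List (SIdx B n × Bool)) →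
      sExpand B u ≈W m → sExpand B u′ ≈W m′ →
      sExpand B t ≈W (m ++ fromℕ< 0<n ∷ m′ ++ [ fromℕ< 0<n ]) →
      eval A τ̂ t ≈ eval A τ̂ u ∙ φ (eval A τ̂ u′)
    r₀-decomposition 0<n {m} {m′} t u u′ u≈m u′≈m′ t≈mr₀m′r₀ = begin
      eval A τ̂ t                           ≈⟨ ι-sExpand t ⟨
      ι (sExpand B t)                      ≈⟨ ι-resp t≈mr₀m′r₀ ⟩
      ι (m ++ r₀ ∷ m′ ++ [ r₀ ])           ≈⟨ ι-resp (≈W-++ʳ _ (EqClosure.symmetric _ u≈m)) ⟩
      ι (sExpand B u ++ r₀ ∷ m′ ++ [ r₀ ]) ≈⟨ ι-sExpand-++ u _ ⟩
      eval A τ̂ u ∙ ι (r₀ ∷ m′ ++ [ r₀ ])   ≈⟨ ∙-congˡ (ι-r₀ (m′ ++ [ r₀ ])) ⟩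
      eval A τ̂ u ∙ φ (ι (m′ ++ [ r₀ ]))    ≈⟨ ∙-congˡ (φ-cong (R-ι (m′ ++ [ r₀ ])) (u′ , refl) ι[m′r₀]≈u′) ⟩
      eval A τ̂ u ∙ φ (eval A τ̂ u′)         ∎
      where
      r₀ = fromℕ< 0<n
      ι-r₀ : ∀ w → ι (r₀ ∷ w) ≈ φ (ι w)
      ι-r₀ w = trans (∙-congʳ (trans (reflexive (≡.cong (λ j → prefix j ⁻¹) (toℕ-fromℕ< 0<n))) ε⁻¹≈ε))
                     (identityˡ _)
      ι[m′r₀]≈u′ : ι (m′ ++ [ r₀ ]) ≈ eval A τ̂ u′
      ι[m′r₀]≈u′ = begin
        ι (m′ ++ [ r₀ ])           ≈⟨ ι-resp (≈W-++ʳ _ (EqClosure.symmetric _ u′≈m′)) ⟩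
        ι (sExpand B u′ ++ [ r₀ ]) ≈⟨ ι-sExpand-++ u′ _ ⟩
        eval A τ̂ u′ ∙ ι [ r₀ ]     ≈⟨ ∙-congˡ (trans (ι-r₀ []) φ-ε) ⟩
        eval A τ̂ u′ ∙ ε            ≈⟨ identityʳ _ ⟩
        eval A τ̂ u′                ∎

module FirstIsomorphism {c ℓ c′ ℓ′ k : Level} (A : Group c ℓ) (B : Group c′ ℓ′)
              (K : Group.Carrier A → Set (k ⊔ ℓ′)) (K-subgroup : IsSubgroup A K)
              (f : Group.Carrier A → Group.Carrier B)
              (f-cong : ∀ {x y} → K x → K y → Group._≈_ A x y → Group._≈_ B (f x) (f y))
              (f-∙ : ∀ {x y} → K x → K y →
                     Group._≈_ B (f (Group._∙_ A x y)) (Group._∙_ B (f x) (f y))) where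
  private
    module A = Group A
    module B = Group B
  open import Algebra.Properties.Group B using (ε⁻¹≈ε; identityˡ-unique; inverseˡ-unique; ⁻¹-injective)
  open import Relation.Binary.Reasoning.Setoid B.setoid

  K-resp : ∀ {x y} → x A.≈ y → K x → K y
  K-resp = proj₁ K-subgroup _ _

  K-ε : K A.ε
  K-ε = proj₁ (proj₂ K-subgroup)

  K-∙ : ∀ {x y} → K x → K y → K (x A.∙ y)
  K-∙ = proj₁ (proj₂ (proj₂ K-subgroup)) _ _

  K-⁻¹ : ∀ {x} → K x → K (x A.⁻¹)
  K-⁻¹ = proj₂ (proj₂ (proj₂ K-subgroup)) _

  f-ε : f A.ε B.≈ B.ε
  f-ε = identityˡ-unique (f A.ε) (f A.ε)
    (B.trans (B.sym (f-∙ K-ε K-ε)) (f-cong (K-∙ K-ε K-ε) K-ε (A.identityˡ A.ε)))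

  f-⁻¹ : ∀ {x} → K x → f (x A.⁻¹) B.≈ f x B.⁻¹
  f-⁻¹ {x} Kx = inverseˡ-unique (f (x A.⁻¹)) (f x) (begin
    f (x A.⁻¹) B.∙ f x ≈⟨ f-∙ (K-⁻¹ Kx) Kx ⟨
    f (x A.⁻¹ A.∙ x)   ≈⟨ f-cong (K-∙ (K-⁻¹ Kx) Kx) K-ε (A.inverseˡ x) ⟩
    f A.ε              ≈⟨ f-ε ⟩
    B.ε                ∎)

  f-\\ : ∀ {x y} → K x → K y → f (x A.⁻¹ A.∙ y) B.≈ f x B.⁻¹ B.∙ f y
  f-\\ Kx Ky = B.trans (f-∙ (K-⁻¹ Kx) Ky) (B.∙-congʳ (f-⁻¹ Kx))

  Kernel : A.Carrier → Set (k ⊔ ℓ′)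
  Kernel x = K x × f x B.≈ B.ε

  Kernel-normal : IsNormalSubgroupOf A Kernel K
  Kernel-normal = Kernel-subgroup , (λ _ → proj₁) , Kernel-conjugate
    where
    Kernel-subgroup : IsSubgroup A Kernel
    Kernel-subgroup =
        (λ x y x≈y (Kx , fx≈ε) → K-resp x≈y Kx , B.trans (B.sym (f-cong Kx (K-resp x≈y Kx) x≈y)) fx≈ε)
      , (K-ε , f-ε)
      , (λ x y (Kx , fx≈ε) (Ky , fy≈ε) →
           K-∙ Kx Ky , B.trans (f-∙ Kx Ky) (B.trans (B.∙-cong fx≈ε fy≈ε) (B.identityˡ B.ε)))
      , (λ x (Kx , fx≈ε) → K-⁻¹ Kx , B.trans (f-⁻¹ Kx) (B.trans (B.⁻¹-cong fx≈ε) ε⁻¹≈ε))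
    Kernel-conjugate : ∀ g x → K g → Kernel x → Kernel ((g A.∙ x) A.∙ g A.⁻¹)
    Kernel-conjugate g x Kg (Kx , fx≈ε) = K-∙ (K-∙ Kg Kx) (K-⁻¹ Kg) , (begin
      f ((g A.∙ x) A.∙ g A.⁻¹)       ≈⟨ f-∙ (K-∙ Kg Kx) (K-⁻¹ Kg) ⟩
      f (g A.∙ x) B.∙ f (g A.⁻¹)     ≈⟨ B.∙-cong (f-∙ Kg Kx) (f-⁻¹ Kg) ⟩
      (f g B.∙ f x) B.∙ f g B.⁻¹     ≈⟨ B.∙-congʳ (B.trans (B.∙-congˡ fx≈ε) (B.identityʳ _)) ⟩
      f g B.∙ f g B.⁻¹               ≈⟨ B.inverseʳ _ ⟩
      B.ε                            ∎)

  Kernel-quotientIso : (∀ b → Σ[ x ∈ A.Carrier ] (K x × f x B.≈ b)) → QuotientIso A B K Kernel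
  Kernel-quotientIso surjective =
      f
    , (λ x y Kx Ky (_ , f[x⁻¹y]≈ε) →
         ⁻¹-injective (inverseˡ-unique _ _ (B.trans (B.sym (f-\\ Kx Ky)) f[x⁻¹y]≈ε)))
    , (λ x y → f-∙)
    , (λ x y Kx Ky fx≈fy → K-∙ (K-⁻¹ Kx) Ky
         , B.trans (f-\\ Kx Ky) (B.trans (B.∙-congʳ (B.⁻¹-cong fx≈fy)) (B.inverseˡ _)))
    , surjective

module ReversibleMix {c₁ ℓ₁ c₂ ℓ₂ : Level} (n : ℕ)
    (G : Group c₁ ℓ₁) (σ : ℕ → Group.Carrier G)
    (H : Group c₂ ℓ₂) (σ′ : ℕ → Group.Carrier H)
    (G-generated : (g : Group.Carrier G) → InRot G n σ g)
    (totallyChiral : TotallyChiral G n σ)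
    (relations : RotRelations (G ×G H) n (λ j → σ j , σ′ j))
    (rev : Reversible (G ×G H) n (λ j → σ j , σ′ j)) where
  private
    A = G ×G H
    module G = Group G
    module H = Group H
    module A = Group A
    τ : ℕ → A.Carrier
    τ j = σ j , σ′ j
  open import Algebra.Properties.Group G using (ε⁻¹≈ε)
  open Words A
  open Reversal A n τ rev
  open CoxeterAction A n τ relations rev

  k : Level
  k = c₁ ⊔ c₂ ⊔ ℓ₁ ⊔ ℓ₂

  K : A.Carrier → Set k
  K x = Lift k (R x)

  K-subgroup : IsSubgroup A K
  K-subgroup = (λ _ _ x≈y Kx → lift (Gen-resp τ̂ x≈y (lower Kx))) , lift (Gen-ε τ̂)
             , (λ _ _ Kx Ky → lift (Gen-∙ τ̂ (lower Kx) (lower Ky)))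
             , (λ _ Kx → lift (Gen-⁻¹ τ̂ (lower Kx)))

  K-coordinates : ∀ x → K x → InRot G n σ (proj₁ x) × InRot H n σ′ (proj₂ x)
  K-coordinates x (lift (w , e)) =
      (w , G.trans (G.reflexive (≡.sym (proj₁-eval G H _ _ w))) (proj₁ e))
    , (w , H.trans (H.reflexive (≡.sym (proj₂-eval G H _ _ w))) (proj₂ e))

  F : A.Carrier → G.Carrier × G.Carrier
  F x = proj₁ x , proj₁ (φ x)

  F-cong : ∀ {x y} → K x → K y → x A.≈ y → Group._≈_ (G ×G G) (F x) (F y)
  F-cong (lift Rx) (lift Ry) x≈y = proj₁ x≈y , proj₁ (φ-cong Rx Ry x≈y)

  F-∙ : ∀ {x y} → K x → K y → Group._≈_ (G ×G G) (F (x A.∙ y)) (Group._∙_ (G ×G G) (F x) (F y))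
  F-∙ (lift Rx) (lift Ry) = G.refl , proj₁ (φ-∙ Rx Ry)

  proj₁-onto : ∀ g → Σ[ y ∈ A.Carrier ] (R y × proj₁ y G.≈ g)
  proj₁-onto g = eval A τ̂ w , (w , A.refl) , G.trans (G.reflexive (proj₁-eval G H _ _ w)) e
    where
    w = proj₁ (G-generated g)
    e = proj₂ (G-generated g)

  twisted-lift : 0 < n → ∀ {y z} → R y → R z →
                 Σ[ x ∈ A.Carrier ] (R x × proj₁ x G.≈ proj₁ y × proj₁ (φ x) G.≈ proj₁ z)
  twisted-lift 0<n {y} {z} Ry Rz
    with t , t≈ ← Gen-∙ τ̂ (Gen-⁻¹ τ̂ Ry) (φ-R Rz)
    with m , m′ , (u , u≈m , u≈ε) , (u′ , u′≈m′ , u′≈ε) , t≈mr₀m′r₀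
           ← totallyChiral 0<n (sExpand G t) (t , EqClosure.reflexive _)
    = x , Gen-∙ τ̂ Ry Rμ , first , second
    where
    μ = eval A τ̂ u
    μ′ = eval A τ̂ u′
    Rμ : R μ
    Rμ = u , A.refl
    Rμ′ : R μ′
    Rμ′ = u′ , A.refl
    proj₁-eval≈ε : ∀ v → eval G (λ a → σ (proj₁ a)) v G.≈ G.ε → proj₁ (eval A τ̂ v) G.≈ G.ε
    proj₁-eval≈ε v = G.trans (G.reflexive (proj₁-eval G H _ _ v))
    decomposition : y A.⁻¹ A.∙ φ z A.≈ μ A.∙ φ μ′
    decomposition = A.trans (A.sym t≈) (r₀-decomposition G 0<n t u u′ u≈m u′≈m′ t≈mr₀m′r₀)
    x = y A.∙ μ
    φx≈ : φ x A.≈ z A.∙ μ′ A.⁻¹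
    φx≈ = y⁻¹φz≈μφμ′⇒φ[yμ]≈zμ′⁻¹ Ry Rz Rμ Rμ′ decomposition
    first : proj₁ x G.≈ proj₁ y
    first = G.trans (G.∙-congˡ (proj₁-eval≈ε u u≈ε)) (G.identityʳ _)
    second : proj₁ (φ x) G.≈ proj₁ z
    second = G.trans (proj₁ φx≈)
      (G.trans (G.∙-congˡ (G.trans (G.⁻¹-cong (proj₁-eval≈ε u′ u′≈ε)) ε⁻¹≈ε)) (G.identityʳ _))

  F-surjective : ∀ b → Σ[ x ∈ A.Carrier ] (K x × Group._≈_ (G ×G G) (F x) b)
  F-surjective (b₁ , b₂) with 0 <? n
  ... | yes 0<n =
    let y , Ry , y≈b₁ = proj₁-onto b₁
        z , Rz , z≈b₂ = proj₁-onto b₂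
        x , Rx , x≈y , φx≈z = twisted-lift 0<n Ry Rz
    in x , lift Rx , G.trans x≈y y≈b₁ , G.trans φx≈z z≈b₂
  ... | no ¬0<n = A.ε , lift (Gen-ε τ̂) , G.sym (trivial b₁) , G.trans (proj₁ φ-ε) (G.sym (trivial b₂))
    where
    trivial : ∀ g → g G.≈ G.ε
    trivial g = Words.Gen-empty G _ (λ (_ , _ , i<n) → ¬0<n (≤-<-trans z≤n i<n)) (G-generated g)

  open FirstIsomorphism {k = k} A (G ×G G) K K-subgroup F F-cong F-∙

  quotient : HasSubgroupWithQuotient A (G ×G G) k
               (λ x → InRot G n σ (proj₁ x) × InRot H n σ′ (proj₂ x))
  quotient = K , Kernel , K-coordinates , K-subgroup , Kernel-normal , Kernel-quotientIso F-surjective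

lemma5p7 : {c₁ ℓ₁ c₂ ℓ₂ : _} (n : ℕ)
    (G : Group c₁ ℓ₁) (σ : ℕ → Group.Carrier G)
    (H : Group c₂ ℓ₂) (ρ : ℕ → Group.Carrier H) →
    ChiralPolytopeGroup G n σ →
    TotallyChiral G n σ →
    DirectlyRegularGroup H n ρ →
    IntersectionProperty (G ×G H) n (mixGens G H σ ρ) →
    ¬ HasSubgroupWithQuotient (G ×G H) (G ×G G) (c₁ ⊔ c₂ ⊔ ℓ₁ ⊔ ℓ₂)
        (λ x → InRot G n σ (proj₁ x) × InRot H n (rotOf H ρ) (proj₂ x)) →
    ChiralRot (G ×G H) n (mixGens G H σ ρ)
-- Neither the chirality of P nor the index-2 condition on Γ⁺(Q) is needed.
lemma5p7 n G σ H ρ (generated , (relations , _) , _) totallyChiral (stringC , _) intersection noQuotient =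
  (mixRelations , intersection) ,
  λ rev → noQuotient (ReversibleMix.quotient n G σ H (rotOf H ρ) generated totallyChiral mixRelations rev)
  where
  mixRelations : RotRelations (G ×G H) n (mixGens G H σ ρ)
  mixRelations = ×-RotRelations G H σ (rotOf H ρ) relations (rotOf-RotRelations H stringC)
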